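{- For every VFS-term $M$ and variable $z$, $(M:z.\uparrow z)\twoheadrightarrow M$ in VFS.
   Context: Terms up to $\alpha$-equivalence; one-step reduction is the closure of the rules under all constructors. VFS: terms $M,N::=\uparrow V\mid \mathsf{C}_v(V,c)$; values $V,W::=x\mid\lambda x.M$; formal contexts $c::= x.M\mid (W,x.M)$ ($x$ bound in $M$). Auxiliary operations: $(\uparrow V:c')=\mathsf{C}_v(V,c')$; $(\mathsf{C}_v(V,c):c')=\mathsf{C}_v(V,(c:c'))$; $((x.M):c')=x.(M:c')$; $((W,x.M):c')=(W,x.(M:c'))$. Rules: $(B_v)$ $\mathsf{C}_v(\lambda x.M,(V,y.N))\to\mathsf{C}_v(V,x.(M:y.N))$; $(\sigma_v)$ $\mathsf{C}_v(V,y.N)\to[V/y]N$ (capture-avoiding substitution). -}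

module Defs where

-- VFS syntax with well-scoped de Bruijn indices (terms are thus identified
-- up to alpha-equivalence).  Term n / Val n / Ctx n have free variables in Fin n.

open import Data.Nat using (ℕ; zero; suc)
open import Data.Fin using (Fin; zero; suc)
open import Relation.Binary.Construct.Closure.ReflexiveTransitive using (Star)

mutual
  -- terms  M,N ::= ↑V | C_v(V,c)
  data Term (n : ℕ) : Set where
    up : Val n → Term n
    cv : Val n → Ctx n → Term n

  data Val (n : ℕ) : Set where
    var : Fin n → Val n
    lam : Term (suc n) → Val n

  -- formal contexts  c ::= x.M | (W, x.M)   (x bound in M)
  data Ctx (n : ℕ) : Set where
    abs  : Term (suc n) → Ctx n
    pair : Val n → Term (suc n) → Ctx n

Ren : ℕ → ℕ → Set
Ren n m = Fin n → Fin m

extR : ∀ {n m} → Ren n m → Ren (suc n) (suc m)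
extR ρ zero    = zero
extR ρ (suc i) = suc (ρ i)

mutual
  renT : ∀ {n m} → Ren n m → Term n → Term m
  renT ρ (up V)   = up (renV ρ V)
  renT ρ (cv V c) = cv (renV ρ V) (renC ρ c)

  renV : ∀ {n m} → Ren n m → Val n → Val m
  renV ρ (var i) = var (ρ i)
  renV ρ (lam M) = lam (renT (extR ρ) M)

  renC : ∀ {n m} → Ren n m → Ctx n → Ctx m
  renC ρ (abs M)    = abs (renT (extR ρ) M)
  renC ρ (pair W M) = pair (renV ρ W) (renT (extR ρ) M)

Sub : ℕ → ℕ → Set
Sub n m = Fin n → Val m

extS : ∀ {n m} → Sub n m → Sub (suc n) (suc m)
extS σ zero    = var zero
extS σ (suc i) = renV suc (σ i)

mutual
  subT : ∀ {n m} → Sub n m → Term n → Term m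
  subT σ (up V)   = up (subV σ V)
  subT σ (cv V c) = cv (subV σ V) (subC σ c)

  subV : ∀ {n m} → Sub n m → Val n → Val m
  subV σ (var i) = σ i
  subV σ (lam M) = lam (subT (extS σ) M)

  subC : ∀ {n m} → Sub n m → Ctx n → Ctx m
  subC σ (abs M)    = abs (subT (extS σ) M)
  subC σ (pair W M) = pair (subV σ W) (subT (extS σ) M)

single : ∀ {n} → Val n → Sub (suc n) n
single V zero    = V
single V (suc i) = var i

_[_] : ∀ {n} → Term (suc n) → Val n → Term n
N [ V ] = subT (single V) N

-- auxiliary operations  (M : c')  and  (c : c')
-- (the bound variable x is fresh for c', so c' is weakened under the binder)
infixl 5 _∶_ _∶c_
mutual
  _∶_ : ∀ {n} → Term n → Ctx n → Term n
  up V   ∶ c' = cv V c'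
  cv V c ∶ c' = cv V (c ∶c c')

  _∶c_ : ∀ {n} → Ctx n → Ctx n → Ctx n
  abs M    ∶c c' = abs (M ∶ renC suc c')
  pair W M ∶c c' = pair W (M ∶ renC suc c')

infix 4 _⟶T_ _⟶V_ _⟶C_
mutual
  data _⟶T_ {n : ℕ} : Term n → Term n → Set where
    Bv  : ∀ (M : Term (suc n)) (V : Val n) (N : Term (suc n)) →
          cv (lam M) (pair V N) ⟶T cv V (abs (M ∶ renC suc (abs N)))
    σv  : ∀ (V : Val n) (N : Term (suc n)) →
          cv V (abs N) ⟶T N [ V ]
    ξup : ∀ {V V'} → V ⟶V V' → up V ⟶T up V'
    ξcvV : ∀ {V V' c} → V ⟶V V' → cv V c ⟶T cv V' c
    ξcvC : ∀ {V c c'} → c ⟶C c' → cv V c ⟶T cv V c'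

  data _⟶V_ {n : ℕ} : Val n → Val n → Set where
    ξlam : ∀ {M M'} → M ⟶T M' → lam M ⟶V lam M'

  data _⟶C_ {n : ℕ} : Ctx n → Ctx n → Set where
    ξabs   : ∀ {M M'} → M ⟶T M' → abs M ⟶C abs M'
    ξpairV : ∀ {W W' M} → W ⟶V W' → pair W M ⟶C pair W' M
    ξpairT : ∀ {W M M'} → M ⟶T M' → pair W M ⟶C pair W M'

infix 4 _↠_
_↠_ : ∀ {n} → Term n → Term n → Set
_↠_ {n} = Star (_⟶T_ {n})

module Submission where

open import Defs
open import Data.Nat using (ℕ)
open import Data.Fin using (zero)
open import Relation.Binary.Construct.Closure.ReflexiveTransitive using (Star; ε; _◅_; gmap)

-- (M : z.↑z) only appends z.↑z at the innermost ↑V of M, where it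
-- σ-reduces to ↑V; the rest of M is congruence.  Weakening z.↑z under a
-- binder gives z.↑z back, so the induction hypothesis applies verbatim.

identityCtx : ∀ {n} → Ctx n
identityCtx = abs (up (var zero))

mutual
  ∶-identityʳ : ∀ {n} (M : Term n) → (M ∶ identityCtx) ↠ M
  ∶-identityʳ (up V)   = σv V (up (var zero)) ◅ ε
  ∶-identityʳ (cv V c) = gmap (cv V) ξcvC (∶c-identityʳ c)

  ∶c-identityʳ : ∀ {n} (c : Ctx n) → Star _⟶C_ (c ∶c identityCtx) c
  ∶c-identityʳ (abs M)    = gmap abs ξabs (∶-identityʳ M)
  ∶c-identityʳ (pair W M) = gmap (pair W) ξpairT (∶-identityʳ M)

lemma8 : ∀ {n : ℕ} (M : Term n) → (M ∶ abs (up (var zero))) ↠ M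
lemma8 = ∶-identityʳ
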